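{- Let $N=p_1\cdots p_n$ be a product of $n\ge1$ distinct primes and let $p$ be a prime not dividing $N$. For $T\subseteq[n]$ write $N_T=\sum_{i\in T}N_i$. Then for every integer $k$, $$a_{pN}(k)-a_{pN}(k-N)=\sum(-1)^{|T|}a_N\bigl(p^{ -1}(k-N_T)\bigr),$$ where the sum ranges over all $T\subseteq[n]$ with $k\equiv N_T\pmod p$ (equivalently, $kN^{ -1}\equiv\sum_{i\in T}\langle p_i^{ -1}\rangle_p\pmod p$), and $p^{ -1}(k-N_T)$ denotes the integer $(k-N_T)/p$.
   Context: For a squarefree $M=q_1\cdots q_m$ ($m\ge1$ distinct primes) write $M_{i_1\cdots i_r}=M/(q_{i_1}\cdots q_{i_r})$ and $P_M(x)=\frac{(1-x^M)\prod_{1\le i<j\le m}(1-x^{M_{ij}})}{\prod_{i=1}^m(1-x^{M_i})}$, a polynomial. $a_M(k)$ denotes the coefficient of $x^k$ in $P_M(x)$, with $a_M(k)=0$ for $k<0$. Here $N_i=N/p_i$. For a rational $c=a/b$ with $b$ coprime to $m$, $\langle c\rangle_m$ is the smallest nonnegative integer $k$ with $kb\equiv a\pmod m$. -}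

module Defs where

open import Data.Nat as ℕ using (ℕ; zero; suc; _<ᵇ_)
open import Data.Integer as ℤ using (ℤ; +_; -[1+_]; _-_; _*_)
open import Data.Integer.DivMod using (_/ℕ_)
open import Data.Integer.Divisibility.Signed using (_∣?_)
open import Data.Bool using (Bool; true; false; if_then_else_)
open import Data.List as List using (List; []; _∷_; _++_; map; foldr)
open import Data.Vec as Vec using (Vec; []; _∷_; toList; zipWith)
open import Data.Fin.Subset using (Subset; inside; outside; ∣_∣)
open import Relation.Nullary.Decidable using (⌊_⌋)

prodℕ : List ℕ → ℕ
prodℕ = foldr ℕ._*_ 1

sumℤ : List ℤ → ℤ
sumℤ = foldr ℤ._+_ (+ 0)

removeOne : {A : Set} → List A → List (List A)
removeOne []       = []
removeOne (x ∷ xs) = xs ∷ map (x ∷_) (removeOne xs)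

removeTwo : {A : Set} → List A → List (List A)
removeTwo []       = []
removeTwo (x ∷ xs) = removeOne xs ++ map (x ∷_) (removeTwo xs)

-- Formal power series over ℤ, as coefficient functions.
Series : Set
Series = ℕ → ℤ

one : Series
one zero    = + 1
one (suc _) = + 0

mulOneMinus : ℕ → Series → Series
mulOneMinus d c k = c k - (if k <ᵇ d then + 0 else c (k ℕ.∸ d))

sumUpTo : ℕ → (ℕ → ℤ) → ℤ
sumUpTo zero    f = f 0
sumUpTo (suc n) f = sumUpTo n f ℤ.+ f (suc n)

-- division by (1 - x^d) for d ≥ 1, i.e. multiplication by sum_j x^(d j)
divOneMinus : ℕ → Series → Series
divOneMinus d c k = sumUpTo k (λ j → if k <ᵇ d ℕ.* j then + 0 else c (k ℕ.∸ d ℕ.* j))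

-- For M = q_1 ⋯ q_m given by the list qs of its prime factors:
-- M_i = M / q_i  and  M_ij = M / (q_i q_j)  (i < j).
Mis : List ℕ → List ℕ
Mis qs = map prodℕ (removeOne qs)

Mijs : List ℕ → List ℕ
Mijs qs = map prodℕ (removeTwo qs)

-- Power series expansion of
--   P_M(x) = (1 - x^M) ∏_{i<j} (1 - x^{M_ij}) / ∏_i (1 - x^{M_i}).
-- (P_M is a polynomial, so these are exactly its coefficients.)
PSeries : List ℕ → Series
PSeries qs = foldr divOneMinus (foldr mulOneMinus (mulOneMinus (prodℕ qs) one) (Mijs qs)) (Mis qs)

a : List ℕ → ℤ → ℤ
a qs (+ k)     = PSeries qs k
a qs -[1+ _ ]  = + 0

-- Exact quotient (k / p) for p ≥ 1 (only used when p ∣ k).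
divBy : ℤ → ℕ → ℤ
divBy k zero    = + 0
divBy k (suc p) = k /ℕ suc p

allSubsets : (n : ℕ) → List (Subset n)
allSubsets zero    = [] ∷ []
allSubsets (suc n) = map (outside ∷_) (allSubsets n) ++ map (inside ∷_) (allSubsets n)

-- N_T = Σ_{i ∈ T} N_i, where N = product of ps and N_i = N / p_i.
-- (Nis ps is the list N_1, ..., N_n, in order.)
Nis : {n : ℕ} → Vec ℕ n → List ℕ
Nis ps = Mis (toList ps)

NT : {n : ℕ} → Vec ℕ n → Subset n → ℕ
NT ps T = foldr ℕ._+_ 0 (List.zipWith (λ b x → if b then x else 0) (toList T) (Nis ps))

signℤ : ℕ → ℤ
signℤ zero    = + 1
signℤ (suc n) = ℤ.- signℤ n

rhs : {n : ℕ} → ℕ → Vec ℕ n → ℤ → ℤ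
rhs {n} p ps k = sumℤ (map term (allSubsets n))
  where
  term : Subset n → ℤ
  term T = if ⌊ + p ∣? (k - + NT ps T) ⌋
             then signℤ ∣ T ∣ * a (toList ps) (divBy (k - + NT ps T) p)
             else + 0

{-# OPTIONS --safe #-}
module Submission where

-- With N = p₁⋯pₙ, the factors of P_{pN} are 1 - x^{pN}, 1 - x^{Nᵢ} and 1 - x^{pNᵢⱼ} over
-- 1 - x^N and 1 - x^{pNᵢ}; those involving p are exactly the factors of P_N(x^p). Hence
-- (1 - x^N) P_{pN}(x) = P_N(x^p) ∏ᵢ (1 - x^{Nᵢ}) as power series (dividing by 1 - x^e commutes
-- with multiplying by 1 - x^d, since multiplication by 1 - x^e is injective). Expanding the
-- product as Σ_T (-1)^{|T|} x^{N_T} and comparing coefficients of x^k gives the formula, because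
-- the coefficient of x^m in P_N(x^p) is a_N(m/p) if p ∣ m and 0 otherwise.

open import Defs
open import Data.Bool using (true; false; if_then_else_)
open import Data.Empty using (⊥-elim)
open import Data.Fin.Subset using (Subset; inside; outside; ∣_∣)
open import Data.Integer as ℤ using (ℤ; +_; -[1+_]; _-_)
open import Data.Integer.Divisibility.Signed using (_∣?_; divides; ∣m∣n⇒∣m+n)
  renaming (_∣_ to _∣ℤ_)
import Data.Integer.Properties as ℤP
open import Data.Integer.Solver using (module +-*-Solver)
open import Data.List as List using (List; []; _∷_; _++_; map; foldr)
import Data.List.Properties as LP
open import Data.List.Relation.Unary.All using (All; []; _∷_)
open import Data.Nat as ℕ using (ℕ; zero; suc; _≤_; _<_; _<ᵇ_; NonZero; z≤n; s≤s)
import Data.Nat.DivMod as ℕD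
open import Data.Nat.Divisibility using (_∣_)
open import Data.Nat.Induction using (<-rec)
open import Data.Nat.ListAction.Properties using (product≢0)
open import Data.Nat.Primality using (Prime; prime⇒nonZero)
import Data.Nat.Properties as ℕP
open import Data.Sum using (inj₁; inj₂)
open import Data.Vec as Vec using (Vec; lookup; toList)
import Data.Vec.Properties as VecP
import Data.Vec.Relation.Unary.All as VecAll
open import Data.Vec.Relation.Unary.All.Properties using (toList⁺; tabulate⁺)
open import Function using (_∘_)
open import Relation.Binary.PropositionalEquality
  using (_≡_; refl; sym; trans; cong; cong₂; subst; _≗_; module ≡-Reasoning)
open import Relation.Nullary using (¬_; Dec; yes; no)
open import Relation.Nullary.Decidable using (⌊_⌋)

open +-*-Solver

<ᵇ-true : ∀ {m n} → m < n → (m <ᵇ n) ≡ true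
<ᵇ-true {m} {n} m<n with m <ᵇ n | ℕP.<⇒<ᵇ m<n
... | true | _ = refl

<ᵇ-false : ∀ {m n} → n ≤ m → (m <ᵇ n) ≡ false
<ᵇ-false {m} {n} n≤m with m <ᵇ n | ℕP.<ᵇ⇒< m n
... | true  | lt = ⊥-elim (ℕP.≤⇒≯ n≤m (lt _))
... | false | _  = refl

mulXPow : ℕ → Series → Series
mulXPow d c k = if k <ᵇ d then + 0 else c (k ℕ.∸ d)

mulXPow-< : ∀ {d} c {k} → k < d → mulXPow d c k ≡ + 0
mulXPow-< c k<d rewrite <ᵇ-true k<d = refl

mulXPow-≥ : ∀ {d} c {k} → d ≤ k → mulXPow d c k ≡ c (k ℕ.∸ d)
mulXPow-≥ c d≤k rewrite <ᵇ-false d≤k = refl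

mulXPow-cong : ∀ d {c c'} → c ≗ c' → mulXPow d c ≗ mulXPow d c'
mulXPow-cong d eq k = cong (if k <ᵇ d then + 0 else_) (eq (k ℕ.∸ d))

extend : Series → ℤ → ℤ
extend c (+ k)    = c k
extend c -[1+ _ ] = + 0

extend-cong : ∀ {c c'} → c ≗ c' → extend c ≗ extend c'
extend-cong eq (+ k)    = eq k
extend-cong eq -[1+ _ ] = refl

a≗extend-PSeries : ∀ qs → a qs ≗ extend (PSeries qs)
a≗extend-PSeries qs (+ k)    = refl
a≗extend-PSeries qs -[1+ _ ] = refl

extend-shift : ∀ c k d → extend c (+ k - + d) ≡ mulXPow d c k
extend-shift c k       zero    = cong (extend c) (ℤP.+-identityʳ (+ k))
extend-shift c zero    (suc d) = refl
extend-shift c (suc k) (suc d) = trans (cong (extend c) +[1+k]-+[1+d]≡+k-+d) (extend-shift c k d)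
  where
  +[1+k]-+[1+d]≡+k-+d : + suc k - + suc d ≡ + k - + d
  +[1+k]-+[1+d]≡+k-+d = trans (ℤP.m-n≡m⊖n (suc k) (suc d))
    (trans (ℤP.[1+m]⊖[1+n]≡m⊖n k d) (sym (ℤP.m-n≡m⊖n k d)))

Δ : ℕ → (ℤ → ℤ) → ℤ → ℤ
Δ d f x = f x - f (x - + d)

Δ-cong : ∀ d {f g} → f ≗ g → Δ d f ≗ Δ d g
Δ-cong d eq x = cong₂ _-_ (eq x) (eq (x - + d))

Δ-comm : ∀ d e f → Δ d (Δ e f) ≗ Δ e (Δ d f)
Δ-comm d e f x = trans (cong (λ y → Δ e f x - (f (x - + d) - f y)) (swap x (+ d) (+ e)))
                       (interchange (f x) (f (x - + e)) (f (x - + d)) _)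
  where
  swap : ∀ x u v → (x - u) - v ≡ (x - v) - u
  swap = solve 3 (λ x u v → (x :- u) :- v := (x :- v) :- u) refl
  interchange : ∀ s t u v → (s - t) - (u - v) ≡ (s - u) - (t - v)
  interchange = solve 4 (λ s t u v → (s :- t) :- (u :- v) := (s :- u) :- (t :- v)) refl

foldr-Δ-cong : ∀ ds {f g} → f ≗ g → foldr Δ f ds ≗ foldr Δ g ds
foldr-Δ-cong []       eq = eq
foldr-Δ-cong (d ∷ ds) eq = Δ-cong d (foldr-Δ-cong ds eq)

extend-mulOneMinus : ∀ d c → extend (mulOneMinus d c) ≗ Δ d (extend c)
extend-mulOneMinus d       c (+ k)    = cong (c k -_) (sym (extend-shift c k d))
extend-mulOneMinus zero    c -[1+ _ ] = refl
extend-mulOneMinus (suc d) c -[1+ _ ] = refl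

extend-foldr-mulOneMinus : ∀ ds c → extend (foldr mulOneMinus c ds) ≗ foldr Δ (extend c) ds
extend-foldr-mulOneMinus []       c x = refl
extend-foldr-mulOneMinus (d ∷ ds) c x =
  trans (extend-mulOneMinus d _ x) (Δ-cong d (extend-foldr-mulOneMinus ds c) x)

mulOneMinus-cong : ∀ d {c c'} → c ≗ c' → mulOneMinus d c ≗ mulOneMinus d c'
mulOneMinus-cong d eq k = cong₂ _-_ (eq k) (mulXPow-cong d eq k)

foldr-mulOneMinus-cong : ∀ ds {c c'} → c ≗ c' → foldr mulOneMinus c ds ≗ foldr mulOneMinus c' ds
foldr-mulOneMinus-cong []       eq = eq
foldr-mulOneMinus-cong (d ∷ ds) eq = mulOneMinus-cong d (foldr-mulOneMinus-cong ds eq)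

mulOneMinus-comm : ∀ d e c → mulOneMinus d (mulOneMinus e c) ≗ mulOneMinus e (mulOneMinus d c)
mulOneMinus-comm d e c k = begin
  extend (mulOneMinus d (mulOneMinus e c)) (+ k) ≡⟨ extend-mulOneMinus d (mulOneMinus e c) (+ k) ⟩
  Δ d (extend (mulOneMinus e c)) (+ k)           ≡⟨ Δ-cong d (extend-mulOneMinus e c) (+ k) ⟩
  Δ d (Δ e (extend c)) (+ k)                     ≡⟨ Δ-comm d e (extend c) (+ k) ⟩
  Δ e (Δ d (extend c)) (+ k)                     ≡⟨ Δ-cong e (extend-mulOneMinus d c) (+ k) ⟨
  Δ e (extend (mulOneMinus d c)) (+ k)           ≡⟨ extend-mulOneMinus e (mulOneMinus d c) (+ k) ⟨
  extend (mulOneMinus e (mulOneMinus d c)) (+ k) ∎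
  where open ≡-Reasoning

mulOneMinus-injective : ∀ d .{{_ : NonZero d}} {c c'} →
  mulOneMinus d c ≗ mulOneMinus d c' → c ≗ c'
mulOneMinus-injective d {c} {c'} eq = <-rec _ agree
  where
  open ≡-Reasoning
  x≡[x-y]+y : ∀ x y → x ≡ (x - y) ℤ.+ y
  x≡[x-y]+y = solve 2 (λ x y → x := (x :- y) :+ y) refl
  shifted : ∀ k → (∀ {j} → j < k → c j ≡ c' j) → mulXPow d c k ≡ mulXPow d c' k
  shifted k ih with k ℕ.<? d
  ... | yes k<d = trans (mulXPow-< c k<d) (sym (mulXPow-< c' k<d))
  ... | no k≮d  = begin
    mulXPow d c k     ≡⟨ mulXPow-≥ c d≤k ⟩
    c (k ℕ.∸ d)       ≡⟨ ih (ℕP.∸-monoʳ-< (ℕ.>-nonZero⁻¹ d) d≤k) ⟩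
    c' (k ℕ.∸ d)      ≡⟨ mulXPow-≥ c' d≤k ⟨
    mulXPow d c' k    ∎
    where d≤k = ℕP.≮⇒≥ k≮d
  agree : ∀ k → (∀ {j} → j < k → c j ≡ c' j) → c k ≡ c' k
  agree k ih = begin
    c k                                    ≡⟨ x≡[x-y]+y (c k) (mulXPow d c k) ⟩
    mulOneMinus d c k ℤ.+ mulXPow d c k    ≡⟨ cong₂ ℤ._+_ (eq k) (shifted k ih) ⟩
    mulOneMinus d c' k ℤ.+ mulXPow d c' k  ≡⟨ x≡[x-y]+y (c' k) (mulXPow d c' k) ⟨
    c' k                                   ∎

sumUpTo-cong : ∀ n {f g : ℕ → ℤ} → f ≗ g → sumUpTo n f ≡ sumUpTo n g
sumUpTo-cong zero    eq = eq 0
sumUpTo-cong (suc n) eq = cong₂ ℤ._+_ (sumUpTo-cong n eq) (eq (suc n))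

sumUpTo-suc : ∀ n (f : ℕ → ℤ) → sumUpTo (suc n) f ≡ f 0 ℤ.+ sumUpTo n (f ∘ suc)
sumUpTo-suc zero    f = refl
sumUpTo-suc (suc n) f = trans (cong (ℤ._+ f (suc (suc n))) (sumUpTo-suc n f)) (ℤP.+-assoc (f 0) _ _)

sumUpTo-truncate : ∀ {m} n (f : ℕ → ℤ) → (∀ j → m < j → f j ≡ + 0) → m ≤ n →
  sumUpTo n f ≡ sumUpTo m f
sumUpTo-truncate zero    f _     z≤n   = refl
sumUpTo-truncate (suc n) f zeros m≤1+n with ℕP.m≤n⇒m<n∨m≡n m≤1+n
... | inj₂ refl       = refl
... | inj₁ (s≤s m≤n) = trans (cong₂ ℤ._+_ (sumUpTo-truncate n f zeros m≤n) (zeros (suc n) (s≤s m≤n)))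
                             (ℤP.+-identityʳ _)

<ᵇ-∸ : ∀ {d k} m → d ≤ k → (k <ᵇ d ℕ.+ m) ≡ (k ℕ.∸ d <ᵇ m)
<ᵇ-∸ m z≤n       = refl
<ᵇ-∸ m (s≤s d≤k) = <ᵇ-∸ m d≤k

divTerm : ℕ → Series → ℕ → ℕ → ℤ
divTerm d c k j = if k <ᵇ d ℕ.* j then + 0 else c (k ℕ.∸ d ℕ.* j)

divTerm-zero : ∀ d c k → divTerm d c k 0 ≡ c k
divTerm-zero d c k rewrite ℕP.*-zeroʳ d = refl

divTerm-> : ∀ d .{{_ : NonZero d}} c {k j} → k < j → divTerm d c k j ≡ + 0
divTerm-> d c {k} {j} k<j rewrite <ᵇ-true (ℕP.<-≤-trans k<j (ℕP.m≤n*m j d)) = refl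

divTerm-suc-< : ∀ d c {k} j → k < d → divTerm d c k (suc j) ≡ + 0
divTerm-suc-< d c j k<d rewrite <ᵇ-true (ℕP.<-≤-trans k<d (ℕP.m≤m*n d (suc j))) = refl

divTerm-suc-≥ : ∀ d c {k} j → d ≤ k → divTerm d c k (suc j) ≡ divTerm d c (k ℕ.∸ d) j
divTerm-suc-≥ d c {k} j d≤k
  rewrite ℕP.*-suc d j | <ᵇ-∸ (d ℕ.* j) d≤k | sym (ℕP.∸-+-assoc k d (d ℕ.* j)) = refl

divOneMinus-cong : ∀ d {c c'} → c ≗ c' → divOneMinus d c ≗ divOneMinus d c'
divOneMinus-cong d eq k = sumUpTo-cong k (λ j → cong (if k <ᵇ d ℕ.* j then + 0 else_) (eq _))

-- The terms j ≥ 1 of the sum defining divOneMinus d c k are those defining divOneMinus d c (k ∸ d).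
divOneMinus-step : ∀ d .{{_ : NonZero d}} c k →
  divOneMinus d c k ≡ c k ℤ.+ mulXPow d (divOneMinus d c) k
divOneMinus-step d c zero = begin
  divTerm d c 0 0                       ≡⟨ divTerm-zero d c 0 ⟩
  c 0                                   ≡⟨ ℤP.+-identityʳ (c 0) ⟨
  c 0 ℤ.+ + 0
    ≡⟨ cong (λ x → c 0 ℤ.+ x) (mulXPow-< (divOneMinus d c) (ℕ.>-nonZero⁻¹ d)) ⟨
  c 0 ℤ.+ mulXPow d (divOneMinus d c) 0 ∎
  where open ≡-Reasoning
divOneMinus-step d c (suc k) = begin
  sumUpTo (suc k) (divTerm d c (suc k))
    ≡⟨ sumUpTo-suc k _ ⟩
  divTerm d c (suc k) 0 ℤ.+ sumUpTo k (divTerm d c (suc k) ∘ suc)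
    ≡⟨ cong₂ ℤ._+_ (divTerm-zero d c (suc k)) tail ⟩
  c (suc k) ℤ.+ mulXPow d (divOneMinus d c) (suc k)
    ∎
  where
  open ≡-Reasoning
  tail : sumUpTo k (divTerm d c (suc k) ∘ suc) ≡ mulXPow d (divOneMinus d c) (suc k)
  tail with suc k ℕ.<? d
  ... | yes 1+k<d = begin
    sumUpTo k (divTerm d c (suc k) ∘ suc) ≡⟨ sumUpTo-truncate k _ (λ j _ → divTerm-suc-< d c j 1+k<d) z≤n ⟩
    divTerm d c (suc k) 1                 ≡⟨ divTerm-suc-< d c 0 1+k<d ⟩
    + 0                                   ≡⟨ mulXPow-< (divOneMinus d c) 1+k<d ⟨
    mulXPow d (divOneMinus d c) (suc k)   ∎
  ... | no 1+k≮d = begin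
    sumUpTo k (divTerm d c (suc k) ∘ suc) ≡⟨ sumUpTo-cong k (λ j → divTerm-suc-≥ d c j d≤1+k) ⟩
    sumUpTo k (divTerm d c k')            ≡⟨ sumUpTo-truncate k _ (λ j → divTerm-> d c) k'≤k ⟩
    divOneMinus d c k'                    ≡⟨ mulXPow-≥ (divOneMinus d c) d≤1+k ⟨
    mulXPow d (divOneMinus d c) (suc k)   ∎
    where
    d≤1+k = ℕP.≮⇒≥ 1+k≮d
    k' = suc k ℕ.∸ d
    k'≤k : k' ≤ k
    k'≤k = ℕP.∸-monoʳ-≤ (suc k) (ℕ.>-nonZero⁻¹ d)

mulOneMinus-divOneMinus : ∀ d .{{_ : NonZero d}} c → mulOneMinus d (divOneMinus d c) ≗ c
mulOneMinus-divOneMinus d c k =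
  trans (cong (_- mulXPow d (divOneMinus d c) k) (divOneMinus-step d c k)) ([x+y]-y≡x (c k) _)
  where
  [x+y]-y≡x : ∀ x y → (x ℤ.+ y) - y ≡ x
  [x+y]-y≡x = solve 2 (λ x y → (x :+ y) :- y := x) refl

divOneMinus-mulOneMinus-comm : ∀ e .{{_ : NonZero e}} d c →
  divOneMinus e (mulOneMinus d c) ≗ mulOneMinus d (divOneMinus e c)
divOneMinus-mulOneMinus-comm e d c = mulOneMinus-injective e λ k → begin
  mulOneMinus e (divOneMinus e (mulOneMinus d c)) k ≡⟨ mulOneMinus-divOneMinus e (mulOneMinus d c) k ⟩
  mulOneMinus d c k                                 ≡⟨ mulOneMinus-cong d (mulOneMinus-divOneMinus e c) k ⟨
  mulOneMinus d (mulOneMinus e (divOneMinus e c)) k ≡⟨ mulOneMinus-comm d e (divOneMinus e c) k ⟩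
  mulOneMinus e (mulOneMinus d (divOneMinus e c)) k ∎
  where open ≡-Reasoning

foldr-divOneMinus-cong : ∀ ds {c c'} → c ≗ c' → foldr divOneMinus c ds ≗ foldr divOneMinus c' ds
foldr-divOneMinus-cong []       eq = eq
foldr-divOneMinus-cong (d ∷ ds) eq = divOneMinus-cong d (foldr-divOneMinus-cong ds eq)

divOneMinus-foldr-mulOneMinus : ∀ e .{{_ : NonZero e}} ds c →
  divOneMinus e (foldr mulOneMinus c ds) ≗ foldr mulOneMinus (divOneMinus e c) ds
divOneMinus-foldr-mulOneMinus e []       c k = refl
divOneMinus-foldr-mulOneMinus e (d ∷ ds) c k =
  trans (divOneMinus-mulOneMinus-comm e d (foldr mulOneMinus c ds) k)
        (mulOneMinus-cong d (divOneMinus-foldr-mulOneMinus e ds c) k)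

foldr-divOneMinus-foldr-mulOneMinus : ∀ ds → All NonZero ds → ∀ es c →
  foldr divOneMinus (foldr mulOneMinus c es) ds ≗ foldr mulOneMinus (foldr divOneMinus c ds) es
foldr-divOneMinus-foldr-mulOneMinus []       []           es c k = refl
foldr-divOneMinus-foldr-mulOneMinus (d ∷ ds) (d≢0 ∷ ds≢0) es c k =
  trans (divOneMinus-cong d (foldr-divOneMinus-foldr-mulOneMinus ds ds≢0 es c) k)
        (divOneMinus-foldr-mulOneMinus d {{d≢0}} es (foldr divOneMinus c ds) k)

divBy-exact : ∀ {x} q p → x ≡ q ℤ.* + suc p → divBy x (suc p) ≡ q
divBy-exact (+ n)    p refl rewrite sym (ℤP.pos-* n (suc p)) = cong +_ (ℕD.m*n/n≡m n (suc p))
divBy-exact -[1+ n ] p refl rewrite ℕD.m*n%n≡0 (suc n) (suc p) {{_}} | ℕD.m*n/n≡m (suc n) (suc p) {{_}} = refl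

-- The coefficient function of f(x^p).
dilate : ℕ → (ℤ → ℤ) → ℤ → ℤ
dilate p f x = if ⌊ + p ∣? x ⌋ then f (divBy x p) else + 0

dilate-∣ : ∀ p f {x} q → x ≡ q ℤ.* + suc p → dilate (suc p) f x ≡ f q
dilate-∣ p f {x} q eq with + suc p ∣? x
... | yes _ = cong f (divBy-exact q p eq)
... | no ∤x = ⊥-elim (∤x (divides q eq))

dilate-∤ : ∀ p f {x} → ¬ (+ p ∣ℤ x) → dilate p f x ≡ + 0
dilate-∤ p f {x} ∤x with + p ∣? x
... | yes ∣x = ⊥-elim (∤x ∣x)
... | no _   = refl

dilate-cong : ∀ p {f g} → f ≗ g → dilate p f ≗ dilate p g
dilate-cong p eq x = cong (if ⌊ + p ∣? x ⌋ then_else + 0) (eq (divBy x p))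

dilate-Δ : ∀ p d f → dilate (suc p) (Δ d f) ≗ Δ (suc p ℕ.* d) (dilate (suc p) f)
dilate-Δ p d f x = by-cases (+ suc p ∣? x)
  where
  by-cases : Dec (+ suc p ∣ℤ x) → dilate (suc p) (Δ d f) x ≡ Δ (suc p ℕ.* d) (dilate (suc p) f) x
  by-cases (yes (divides q x≡qp)) = begin
    dilate (suc p) (Δ d f) x
      ≡⟨ dilate-∣ p (Δ d f) q x≡qp ⟩
    f q - f (q - + d)
      ≡⟨ cong₂ _-_ (dilate-∣ p f q x≡qp) (dilate-∣ p f (q - + d) x-pd≡[q-d]p) ⟨
    Δ (suc p ℕ.* d) (dilate (suc p) f) x
      ∎
    where
    open ≡-Reasoning
    x-pd≡[q-d]p : x - + (suc p ℕ.* d) ≡ (q - + d) ℤ.* + suc p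
    x-pd≡[q-d]p = trans (cong₂ _-_ x≡qp (ℤP.pos-* (suc p) d))
                        (solve 3 (λ q P D → q :* P :- P :* D := (q :- D) :* P) refl q (+ suc p) (+ d))
  by-cases (no ∤x) = trans (dilate-∤ (suc p) (Δ d f) ∤x)
                           (sym (cong₂ _-_ (dilate-∤ (suc p) f ∤x) (dilate-∤ (suc p) f ∤x-pd)))
    where
    p∣pd : + suc p ∣ℤ + (suc p ℕ.* d)
    p∣pd = divides (+ d) (trans (ℤP.pos-* (suc p) d) (ℤP.*-comm (+ suc p) (+ d)))
    [x-y]+y≡x : ∀ x y → (x - y) ℤ.+ y ≡ x
    [x-y]+y≡x = solve 2 (λ x y → (x :- y) :+ y := x) refl
    ∤x-pd : ¬ (+ suc p ∣ℤ x - + (suc p ℕ.* d))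
    ∤x-pd ∣x-pd = ∤x (subst (+ suc p ∣ℤ_) ([x-y]+y≡x x _) (∣m∣n⇒∣m+n ∣x-pd p∣pd))

dilateSeries : ℕ → Series → Series
dilateSeries p c k = dilate p (extend c) (+ k)

extend-dilateSeries : ∀ p c → extend (dilateSeries (suc p) c) ≗ dilate (suc p) (extend c)
extend-dilateSeries p c (+ k)    = refl
extend-dilateSeries p c -[1+ n ] = by-cases (+ suc p ∣? -[1+ n ])
  where
  by-cases : Dec (+ suc p ∣ℤ -[1+ n ]) → + 0 ≡ dilate (suc p) (extend c) -[1+ n ]
  by-cases (no ∤x) = sym (dilate-∤ (suc p) (extend c) ∤x)
  by-cases (yes (divides -[1+ m ] x≡qp)) = sym (dilate-∣ p (extend c) -[1+ m ] x≡qp)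
  by-cases (yes (divides (+ m)    x≡qp)) with trans x≡qp (sym (ℤP.pos-* m (suc p)))
  ... | ()

dilateSeries-cong : ∀ p {c c'} → c ≗ c' → dilateSeries p c ≗ dilateSeries p c'
dilateSeries-cong p eq k = dilate-cong p (extend-cong eq) (+ k)

dilateSeries-one : ∀ p → dilateSeries (suc p) one ≗ one
dilateSeries-one p zero    = dilate-∣ p (extend one) (+ 0) refl
dilateSeries-one p (suc k) = by-cases (+ suc p ∣? + suc k)
  where
  by-cases : Dec (+ suc p ∣ℤ + suc k) → dilateSeries (suc p) one (suc k) ≡ + 0
  by-cases (no ∤x) = dilate-∤ (suc p) (extend one) ∤x
  by-cases (yes (divides -[1+ m ]   x≡qp)) = dilate-∣ p (extend one) -[1+ m ] x≡qp
  by-cases (yes (divides (+ suc m)  x≡qp)) = dilate-∣ p (extend one) (+ suc m) x≡qp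
  by-cases (yes (divides (+ zero)   ()))

dilateSeries-mulOneMinus : ∀ p d c →
  dilateSeries (suc p) (mulOneMinus d c) ≗ mulOneMinus (suc p ℕ.* d) (dilateSeries (suc p) c)
dilateSeries-mulOneMinus p d c k = begin
  dilate (suc p) (extend (mulOneMinus d c)) (+ k)
    ≡⟨ dilate-cong (suc p) (extend-mulOneMinus d c) (+ k) ⟩
  dilate (suc p) (Δ d (extend c)) (+ k)
    ≡⟨ dilate-Δ p d (extend c) (+ k) ⟩
  Δ (suc p ℕ.* d) (dilate (suc p) (extend c)) (+ k)
    ≡⟨ Δ-cong (suc p ℕ.* d) (extend-dilateSeries p c) (+ k) ⟨
  Δ (suc p ℕ.* d) (extend (dilateSeries (suc p) c)) (+ k)
    ≡⟨ extend-mulOneMinus (suc p ℕ.* d) (dilateSeries (suc p) c) (+ k) ⟨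
  mulOneMinus (suc p ℕ.* d) (dilateSeries (suc p) c) k
    ∎
  where open ≡-Reasoning

dilateSeries-divOneMinus : ∀ p d .{{_ : NonZero d}} c →
  dilateSeries (suc p) (divOneMinus d c) ≗ divOneMinus (suc p ℕ.* d) (dilateSeries (suc p) c)
dilateSeries-divOneMinus p d c = mulOneMinus-injective (suc p ℕ.* d) λ k → begin
  mulOneMinus (suc p ℕ.* d) (dilateSeries (suc p) (divOneMinus d c)) k
    ≡⟨ dilateSeries-mulOneMinus p d (divOneMinus d c) k ⟨
  dilateSeries (suc p) (mulOneMinus d (divOneMinus d c)) k
    ≡⟨ dilateSeries-cong (suc p) (mulOneMinus-divOneMinus d c) k ⟩
  dilateSeries (suc p) c k
    ≡⟨ mulOneMinus-divOneMinus (suc p ℕ.* d) (dilateSeries (suc p) c) k ⟨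
  mulOneMinus (suc p ℕ.* d) (divOneMinus (suc p ℕ.* d) (dilateSeries (suc p) c)) k ∎
  where
  open ≡-Reasoning
  instance _ = ℕP.m*n≢0 (suc p) d

dilateSeries-foldr-mulOneMinus : ∀ p ds c →
  dilateSeries (suc p) (foldr mulOneMinus c ds) ≗ foldr mulOneMinus (dilateSeries (suc p) c) (map (suc p ℕ.*_) ds)
dilateSeries-foldr-mulOneMinus p []       c k = refl
dilateSeries-foldr-mulOneMinus p (d ∷ ds) c k =
  trans (dilateSeries-mulOneMinus p d (foldr mulOneMinus c ds) k)
        (mulOneMinus-cong (suc p ℕ.* d) (dilateSeries-foldr-mulOneMinus p ds c) k)

dilateSeries-foldr-divOneMinus : ∀ p ds → All NonZero ds → ∀ c →
  dilateSeries (suc p) (foldr divOneMinus c ds) ≗ foldr divOneMinus (dilateSeries (suc p) c) (map (suc p ℕ.*_) ds)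
dilateSeries-foldr-divOneMinus p []       []           c k = refl
dilateSeries-foldr-divOneMinus p (d ∷ ds) (d≢0 ∷ ds≢0) c k =
  trans (dilateSeries-divOneMinus p d {{d≢0}} (foldr divOneMinus c ds) k)
        (divOneMinus-cong (suc p ℕ.* d) (dilateSeries-foldr-divOneMinus p ds ds≢0 c) k)

sumℤ-++ : ∀ xs ys → sumℤ (xs ++ ys) ≡ sumℤ xs ℤ.+ sumℤ ys
sumℤ-++ []       ys = sym (ℤP.+-identityˡ _)
sumℤ-++ (x ∷ xs) ys = trans (cong (λ z → x ℤ.+ z) (sumℤ-++ xs ys)) (sym (ℤP.+-assoc x _ _))

sumℤ-map-neg : ∀ {A : Set} (g : A → ℤ) xs → sumℤ (map (ℤ.-_ ∘ g) xs) ≡ ℤ.- sumℤ (map g xs)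
sumℤ-map-neg g []       = refl
sumℤ-map-neg g (x ∷ xs) =
  trans (cong (λ z → ℤ.- g x ℤ.+ z) (sumℤ-map-neg g xs)) (sym (ℤP.neg-distrib-+ (g x) _))

subsetSum : {m : ℕ} → List ℕ → Subset m → ℕ
subsetSum ds T = foldr ℕ._+_ 0 (List.zipWith (λ b x → if b then x else 0) (toList T) ds)

foldr-Δ-expand : ∀ m ds → List.length ds ≡ m → ∀ f x →
  foldr Δ f ds x ≡ sumℤ (map (λ T → signℤ ∣ T ∣ ℤ.* f (x - + subsetSum ds T)) (allSubsets m))
foldr-Δ-expand zero    []       refl f x =
  sym (trans (ℤP.+-identityʳ _) (trans (ℤP.*-identityˡ _) (cong f (ℤP.+-identityʳ x))))
foldr-Δ-expand (suc m) (d ∷ ds) refl f x = begin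
  foldr Δ f ds x - foldr Δ f ds (x - + d)
    ≡⟨ cong₂ _-_ (foldr-Δ-expand m ds refl f x) (foldr-Δ-expand m ds refl f (x - + d)) ⟩
  sumℤ (map (term x) S) - sumℤ (map (term (x - + d)) S)
    ≡⟨ cong₂ ℤ._+_ (cong sumℤ (LP.map-∘ S))
                   (trans (sym (sumℤ-map-neg (term (x - + d)) S))
                          (trans (cong sumℤ (LP.map-cong (sym ∘ term-inside) S)) (cong sumℤ (LP.map-∘ S)))) ⟩
  sumℤ (map term′ (map (outside Vec.∷_) S)) ℤ.+ sumℤ (map term′ (map (inside Vec.∷_) S))
    ≡⟨ sumℤ-++ (map term′ (map (outside Vec.∷_) S)) _ ⟨
  sumℤ (map term′ (map (outside Vec.∷_) S) ++ map term′ (map (inside Vec.∷_) S))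
    ≡⟨ cong sumℤ (LP.map-++ term′ (map (outside Vec.∷_) S) _) ⟨
  sumℤ (map term′ (allSubsets (suc m))) ∎
  where
  open ≡-Reasoning
  S = allSubsets m
  term : ℤ → Subset m → ℤ
  term y T = signℤ ∣ T ∣ ℤ.* f (y - + subsetSum ds T)
  term′ : Subset (suc m) → ℤ
  term′ T = signℤ ∣ T ∣ ℤ.* f (x - + subsetSum (d ∷ ds) T)
  x-[d+n]≡x-d-n : ∀ n → x - + (d ℕ.+ n) ≡ (x - + d) - + n
  x-[d+n]≡x-d-n n = trans (cong (λ z → x - z) (ℤP.pos-+ d n))
    (solve 3 (λ x d n → x :- (d :+ n) := (x :- d) :- n) refl x (+ d) (+ n))
  term-inside : ∀ T → term′ (inside Vec.∷ T) ≡ ℤ.- term (x - + d) T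
  term-inside T = trans (sym (ℤP.neg-distribˡ-* (signℤ ∣ T ∣) _))
    (cong (λ z → ℤ.- (signℤ ∣ T ∣ ℤ.* f z)) (x-[d+n]≡x-d-n (subsetSum ds T)))

map-prodℕ-cons : ∀ p (Ls : List (List ℕ)) → map prodℕ (map (p ∷_) Ls) ≡ map (p ℕ.*_) (map prodℕ Ls)
map-prodℕ-cons p []       = refl
map-prodℕ-cons p (L ∷ Ls) = cong (p ℕ.* prodℕ L ∷_) (map-prodℕ-cons p Ls)

Mis-cons : ∀ p qs → Mis (p ∷ qs) ≡ prodℕ qs ∷ map (p ℕ.*_) (Mis qs)
Mis-cons p qs = cong (prodℕ qs ∷_) (map-prodℕ-cons p (removeOne qs))

Mijs-cons : ∀ p qs → Mijs (p ∷ qs) ≡ Mis qs ++ map (p ℕ.*_) (Mijs qs)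
Mijs-cons p qs = trans (LP.map-++ prodℕ (removeOne qs) _) (cong (Mis qs ++_) (map-prodℕ-cons p (removeTwo qs)))

length-Mis : ∀ qs → List.length (Mis qs) ≡ List.length qs
length-Mis []       = refl
length-Mis (q ∷ qs) = cong suc (begin
  List.length (map prodℕ (map (q ∷_) (removeOne qs))) ≡⟨ cong List.length (map-prodℕ-cons q (removeOne qs)) ⟩
  List.length (map (q ℕ.*_) (Mis qs))                ≡⟨ LP.length-map (q ℕ.*_) (Mis qs) ⟩
  List.length (Mis qs)                               ≡⟨ length-Mis qs ⟩
  List.length qs                                     ∎)
  where open ≡-Reasoning

map-*-nonZero : ∀ p .{{_ : NonZero p}} {ds} → All NonZero ds → All NonZero (map (p ℕ.*_) ds)
map-*-nonZero p         []           = []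
map-*-nonZero p {d ∷ _} (d≢0 ∷ ds≢0) = ℕP.m*n≢0 p d ∷ map-*-nonZero p ds≢0
  where instance _ = d≢0

Mis-nonZero : ∀ {qs} → All NonZero qs → All NonZero (Mis qs)
Mis-nonZero {[]}     []           = []
Mis-nonZero {q ∷ qs} (q≢0 ∷ qs≢0) rewrite Mis-cons q qs =
  product≢0 qs≢0 ∷ map-*-nonZero q {{q≢0}} (Mis-nonZero qs≢0)

mulOneMinus-PSeries-cons : ∀ p qs → All NonZero qs →
  mulOneMinus (prodℕ qs) (PSeries (suc p ∷ qs)) ≗ foldr mulOneMinus (dilateSeries (suc p) (PSeries qs)) (Mis qs)
mulOneMinus-PSeries-cons p qs qs≢0 k = begin
  mulOneMinus N (PSeries (P ∷ qs)) k
    ≡⟨ cong (λ c → mulOneMinus N c k) PSeries-cons ⟩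
  mulOneMinus N (divOneMinus N (foldr divOneMinus (foldr mulOneMinus Y Ns) pNs)) k
    ≡⟨ mulOneMinus-divOneMinus N (foldr divOneMinus (foldr mulOneMinus Y Ns) pNs) k ⟩
  foldr divOneMinus (foldr mulOneMinus Y Ns) pNs k
    ≡⟨ foldr-divOneMinus-foldr-mulOneMinus pNs (map-*-nonZero P Ns≢0) Ns Y k ⟩
  foldr mulOneMinus (foldr divOneMinus Y pNs) Ns k
    ≡⟨ foldr-mulOneMinus-cong Ns dilateSeries-PSeries k ⟨
  foldr mulOneMinus (dilateSeries P (PSeries qs)) Ns k ∎
  where
  open ≡-Reasoning
  P = suc p
  N = prodℕ qs
  Ns = Mis qs
  pNs = map (P ℕ.*_) Ns
  pNij = map (P ℕ.*_) (Mijs qs)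
  Y = foldr mulOneMinus (mulOneMinus (P ℕ.* N) one) pNij
  Ns≢0 = Mis-nonZero qs≢0
  instance _ = product≢0 qs≢0
  PSeries-cons : PSeries (P ∷ qs) ≡ divOneMinus N (foldr divOneMinus (foldr mulOneMinus Y Ns) pNs)
  PSeries-cons = trans
    (cong₂ (λ ds es → foldr divOneMinus (foldr mulOneMinus (mulOneMinus (P ℕ.* N) one) es) ds)
           (Mis-cons P qs) (Mijs-cons P qs))
    (cong (λ c → divOneMinus N (foldr divOneMinus c pNs)) (LP.foldr-++ mulOneMinus _ Ns pNij))
  dilateSeries-PSeries : dilateSeries P (PSeries qs) ≗ foldr divOneMinus Y pNs
  dilateSeries-PSeries i = trans (dilateSeries-foldr-divOneMinus p Ns Ns≢0 _ i)
    (foldr-divOneMinus-cong pNs (λ j → trans (dilateSeries-foldr-mulOneMinus p (Mijs qs) _ j)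
      (foldr-mulOneMinus-cong pNij (λ l → trans (dilateSeries-mulOneMinus p N one l)
        (mulOneMinus-cong (P ℕ.* N) (dilateSeries-one p) l)) j)) i)

*-if-else-0 : ∀ s b u → s ℤ.* (if b then u else + 0) ≡ (if b then s ℤ.* u else + 0)
*-if-else-0 s true  u = refl
*-if-else-0 s false u = ℤP.*-zeroʳ s

mainTheorem11 : (n : ℕ) → 1 ≤ n → (ps : Vec ℕ n) →
    (∀ i → Prime (lookup ps i)) →
    (∀ i j → lookup ps i ≡ lookup ps j → i ≡ j) →
    (p : ℕ) → Prime p → ¬ (p ∣ prodℕ (toList ps)) →
    (k : ℤ) →
    a (p ∷ toList ps) k - a (p ∷ toList ps) (k - + prodℕ (toList ps)) ≡ rhs p ps k
mainTheorem11 n _ ps ps-prime _ zero    p-prime _ k = ⊥-elim (ℕ.≢-nonZero⁻¹ 0 {{prime⇒nonZero p-prime}} refl)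
mainTheorem11 n _ ps ps-prime _ (suc p) _       _ k = begin
  Δ N (a (P ∷ qs)) k
    ≡⟨ Δ-cong N (a≗extend-PSeries (P ∷ qs)) k ⟩
  Δ N (extend (PSeries (P ∷ qs))) k
    ≡⟨ extend-mulOneMinus N (PSeries (P ∷ qs)) k ⟨
  extend (mulOneMinus N (PSeries (P ∷ qs))) k
    ≡⟨ extend-cong (mulOneMinus-PSeries-cons p qs qs≢0) k ⟩
  extend (foldr mulOneMinus (dilateSeries P (PSeries qs)) Ns) k
    ≡⟨ extend-foldr-mulOneMinus Ns _ k ⟩
  foldr Δ (extend (dilateSeries P (PSeries qs))) Ns k
    ≡⟨ foldr-Δ-cong Ns dilate-a k ⟩
  foldr Δ (dilate P (a qs)) Ns k
    ≡⟨ foldr-Δ-expand n Ns length-Ns (dilate P (a qs)) k ⟩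
  sumℤ (map (λ T → signℤ ∣ T ∣ ℤ.* dilate P (a qs) (k - + NT ps T)) (allSubsets n))
    ≡⟨ cong sumℤ (LP.map-cong (λ T → *-if-else-0 (signℤ ∣ T ∣) _ _) (allSubsets n)) ⟩
  rhs P ps k
    ∎
  where
  open ≡-Reasoning
  P = suc p
  qs = toList ps
  N = prodℕ qs
  Ns = Mis qs
  qs≢0 : All NonZero qs
  qs≢0 = toList⁺ (subst (VecAll.All NonZero) (VecP.tabulate∘lookup ps)
                         (tabulate⁺ (prime⇒nonZero ∘ ps-prime)))
  length-Ns : List.length Ns ≡ n
  length-Ns = trans (length-Mis qs) (VecP.length-toList ps)
  dilate-a : extend (dilateSeries P (PSeries qs)) ≗ dilate P (a qs)
  dilate-a x = trans (extend-dilateSeries p (PSeries qs) x) (dilate-cong P (sym ∘ a≗extend-PSeries qs) x)
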